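{- Let $n\geq 7$ and let $T^{*}$ be a chemical tree on $n$ vertices such that $ZC_{1}^{*}(T^{*})\geq ZC_{1}^{*}(T)$ for every chemical tree $T$ on $n$ vertices. Then $T^{*}$ does not contain both a vertex of degree $2$ and a vertex of degree $3$.
   Context: A chemical tree is a tree in which every vertex has degree at most $4$. For a vertex $v$ of a graph $G$, $d_v$ denotes its degree and $\tau_v$ denotes the number of vertices at distance exactly $2$ from $v$. The modified first Zagreb connection index is $ZC_{1}^{*}(G)=\sum_{v\in V(G)}d_{v}\tau_{v}$. -}

module Defs where

open import Data.Bool using (Bool; true; false; T; not; _∧_; if_then_else_)
open import Data.Nat using (ℕ; _≤_; _+_; _*_)
open import Data.Fin using (Fin; _≟_)
open import Data.List using (List; []; _∷_; map; allFin; length; _∷ʳ_)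
open import Data.Nat.ListAction using (sum)
open import Data.Bool.ListAction using (any)
open import Data.List.Relation.Unary.Linked using (Linked)
open import Data.List.Relation.Unary.Unique.Propositional using (Unique)
open import Data.Product using (Σ; _×_)
open import Relation.Binary.PropositionalEquality using (_≡_)
open import Relation.Nullary using (¬_)
open import Relation.Nullary.Decidable using (⌊_⌋)

record Graph (n : ℕ) : Set where
  field
    adj    : Fin n → Fin n → Bool
    sym    : ∀ u v → adj u v ≡ adj v u
    irrefl : ∀ v → adj v v ≡ false
open Graph public

module _ {n : ℕ} (G : Graph n) where

  Adj : Fin n → Fin n → Set
  Adj u v = T (adj G u v)

  data Walk : Fin n → Fin n → Set where
    here : ∀ v → Walk v v
    step : ∀ {u w v} → Adj u w → Walk w v → Walk u v

  Connected : Set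
  Connected = ∀ u v → Walk u v

  -- a cycle: at least 3 distinct vertices x ∷ xs, consecutive ones adjacent,
  -- and the last adjacent to the first
  IsCycle : List (Fin n) → Set
  IsCycle [] = Empty
    where open import Data.Empty using () renaming (⊥ to Empty)
  IsCycle (x ∷ xs) = (2 ≤ length xs) × Unique (x ∷ xs) × Linked Adj ((x ∷ xs) ∷ʳ x)

  Acyclic : Set
  Acyclic = ∀ (c : List (Fin n)) → ¬ IsCycle c

  IsTree : Set
  IsTree = Connected × Acyclic

  countV : (Fin n → Bool) → ℕ
  countV p = sum (map (λ w → if p w then 1 else 0) (allFin n))

  deg : Fin n → ℕ
  deg v = countV (adj G v)

  dist2 : Fin n → Fin n → Bool
  dist2 v w = not ⌊ v ≟ w ⌋ ∧ not (adj G v w) ∧ any (λ u → adj G v u ∧ adj G u w) (allFin n)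

  τ : Fin n → ℕ
  τ v = countV (dist2 v)

  ZC₁* : ℕ
  ZC₁* = sum (map (λ v → deg v * τ v) (allFin n))

  Chemical : Set
  Chemical = ∀ v → deg v ≤ 4

  ChemicalTree : Set
  ChemicalTree = IsTree × Chemical

module Submission where

-- In a tree there are no triangles or 4-cycles, so τ_v = S_v − d_v with
-- S_v = Σ_{u ~ v} d_u; hence ZC₁* = ⟨d, A d⟩ − ⟨d, d⟩ for the adjacency
-- matrix A and degree vector d.  A branch move deletes an edge x–r and adds
-- r–y, where y lies outside the component of r in T − xr; it keeps T a tree,
-- keeps it chemical when d_y ≤ 3, and changes ZC₁* by
--   2(S_y − S_x) − 2A_xy + 2d_r(d_y − d_x + 2) − 2(d_y − d_x + 1).
-- For d_v = 2, d_w = 3, moving a branch r from v to w and a branch r′ from w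
-- to v gains 6d_r + 2d_r′ − 4 − 4A_vw in total, so maximality forces
-- 3d_r + d_r′ ≤ 2 + 2A_vw.  If v ≁ w this is impossible; if v ~ w all other
-- neighbours of v and w are leaves and T has at most 5 vertices.

open import Level using (0ℓ)
open import Algebra.Bundles using (Semiring)
import Algebra.Properties.Semiring.Sum as SemiringSum
open import Data.Bool using (Bool; true; false; T; T?; not; _∧_; _∨_; if_then_else_)
open import Data.Bool.Properties using (T-∧; T-∨; T-≡; T-not-≡; ∧-identityʳ; ∧-zeroʳ; ∧-comm; ∨-comm; ∧-idem)
open import Data.Bool.ListAction using (any)
open import Data.Empty using (⊥; ⊥-elim)
open import Data.Fin using (Fin; zero; suc; _≟_)
open import Data.Fin.Properties using (suc-injective; injective⇒≤)
open import Data.List using (List; []; _∷_; _∷ʳ_; _++_; length; map; allFin; tabulate)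
open import Data.List.Membership.Propositional using (_∈_)
open import Data.List.Properties using (length-++; ++-assoc; ∷-injectiveʳ)
open import Data.List.Relation.Unary.All as All using (All; []; _∷_)
import Data.List.Relation.Unary.All.Properties as All
open import Data.List.Relation.Unary.All.Properties.Core using (¬Any⇒All¬)
open import Data.List.Relation.Unary.Linked as Linked using (Linked; []; [-]; _∷_)
open import Data.List.Relation.Unary.AllPairs using ([]; _∷_)
open import Data.List.Relation.Unary.Unique.Propositional using (Unique)
open import Data.List.Membership.Propositional.Properties using (∈-allFin)
open import Data.List.Relation.Unary.Any as Any using (here; there; satisfied)
open import Data.List.Relation.Unary.Any.Properties using (any⁺; any⁻)
open import Data.Nat as ℕ using (ℕ; zero; suc; _≤_; s≤s; z≤n)
import Data.Nat.Properties as ℕP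
open import Data.Nat.ListAction using () renaming (sum to listSum)
open import Data.Product using (Σ; ∃; _×_; _,_; proj₁; proj₂)
open import Data.Sum using (_⊎_; inj₁; inj₂)
open import Data.Unit using (tt)
open import Function.Base using (_∘_; _∘₂_; case_of_)
open import Function.Bundles using (Equivalence)
open import Defs hiding (sym; irrefl)
open import Relation.Binary.PropositionalEquality
open import Relation.Nullary using (¬_; Dec; yes; no)
open import Relation.Nullary.Decidable using (⌊_⌋; toWitness; fromWitness; fromWitnessFalse)
import Data.Integer.Properties as ℤP
open import Data.Integer as ℤ using (ℤ; +_; -_; _+_; _-_; _*_)
open import Data.Integer.Tactic.RingSolver using (solve-∀)
open import Data.Vec.Functional using (Vector)

private variable n : ℕ

module SumFacts (R : Semiring 0ℓ 0ℓ) where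
  open Semiring R using (Carrier; _≈_; 0#; +-cong; +-congˡ; +-congʳ; +-identityˡ; +-identityʳ)
    renaming (refl to ≈-refl; trans to ≈-trans)
  open SemiringSum R using (sum)

  sum-zero : (f : Fin n → Carrier) → (∀ p → f p ≈ 0#) → sum f ≈ 0#
  sum-zero {zero} f z = ≈-refl
  sum-zero {suc n} f z = ≈-trans (+-cong (z zero) (sum-zero (λ p → f (suc p)) (λ p → z (suc p)))) (+-identityˡ 0#)

  sum-single : (f : Fin n → Carrier) (a : Fin n) → (∀ p → ¬ p ≡ a → f p ≈ 0#) → sum f ≈ f a
  sum-single f zero z = ≈-trans (+-congˡ (sum-zero _ (λ p → z (suc p) λ ()))) (+-identityʳ _)
  sum-single f (suc a) z = ≈-trans (+-congʳ (z zero λ ())) (≈-trans (+-identityˡ _)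
    (sum-single (λ p → f (suc p)) a (λ p p≢a → z (suc p) (λ e → p≢a (suc-injective e)))))

module ℕΣ where
  open SemiringSum ℕP.+-*-semiring public
  open SumFacts ℕP.+-*-semiring public

module ℤΣ where
  open SemiringSum ℤP.+-*-semiring public
  open SumFacts ℤP.+-*-semiring public

listSum-allFin : (f : Fin n → ℕ) → listSum (map f (allFin n)) ≡ ℕΣ.sum f
listSum-allFin f = go f (λ i → i)
  where
  go : ∀ {n} {A : Set} (f : A → ℕ) (g : Fin n → A) → listSum (map f (tabulate g)) ≡ ℕΣ.sum (λ i → f (g i))
  go {zero} f g = refl
  go {suc n} f g = cong (f (g zero) ℕ.+_) (go f (λ i → g (suc i)))

_==_ : Fin n → Fin n → Bool
a == b = ⌊ a ≟ b ⌋

==-sound : {a b : Fin n} → T (a == b) → a ≡ b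
==-sound = toWitness

==-refl : (a : Fin n) → T (a == a)
==-refl a = fromWitness refl

==-≢ : {a b : Fin n} → ¬ a ≡ b → T (not (a == b))
==-≢ = fromWitnessFalse

T⇒≡true : ∀ {b} → T b → b ≡ true
T⇒≡true = Equivalence.to T-≡

T-not⇒≡false : ∀ {b} → T (not b) → b ≡ false
T-not⇒≡false = Equivalence.to T-not-≡

≡true⇒T : ∀ {b} → b ≡ true → T b
≡true⇒T = Equivalence.from T-≡

¬T⇒≡false : ∀ {b} → ¬ T b → b ≡ false
¬T⇒≡false {false} _ = refl
¬T⇒≡false {true} nb = ⊥-elim (nb tt)

T-not : ∀ {b} → T (not b) → ¬ T b
T-not {true} () _

ind : Bool → ℕ
ind b = if b then 1 else 0

count : (Fin n → Bool) → ℕ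
count p = ℕΣ.sum (λ j → ind (p j))

_∖_ : (Fin n → Bool) → Fin n → Fin n → Bool
(p ∖ i) j = p j ∧ not (j == i)

∖-sound : ∀ {p : Fin n → Bool} {i j} → T ((p ∖ i) j) → T (p j) × ¬ j ≡ i
∖-sound t with Equivalence.to T-∧ t
... | pj , j≠i = pj , λ j≡i → T-not j≠i (fromWitness j≡i)

∖-intro : ∀ {p : Fin n → Bool} {i j} → T (p j) → ¬ j ≡ i → T ((p ∖ i) j)
∖-intro pj j≢i = Equivalence.from T-∧ (pj , ==-≢ j≢i)

count-split : (p : Fin n → Bool) (i : Fin n) → count p ≡ ind (p i) ℕ.+ count (p ∖ i)
count-split p i = begin
  count p                                       ≡⟨ ℕΣ.sum-cong-≗ split ⟩
  ℕΣ.sum (λ j → at j ℕ.+ ind ((p ∖ i) j))       ≡⟨ ℕΣ.∑-distrib-+ at (λ j → ind ((p ∖ i) j)) ⟩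
  ℕΣ.sum at ℕ.+ count (p ∖ i)                   ≡⟨ cong (ℕ._+ count (p ∖ i)) (ℕΣ.sum-single at i off-i) ⟩
  ind (p i ∧ (i == i)) ℕ.+ count (p ∖ i)        ≡⟨ cong (λ b → ind (p i ∧ b) ℕ.+ count (p ∖ i)) (T⇒≡true (==-refl i)) ⟩
  ind (p i ∧ true) ℕ.+ count (p ∖ i)            ≡⟨ cong (λ b → ind b ℕ.+ count (p ∖ i)) (∧-identityʳ (p i)) ⟩
  ind (p i) ℕ.+ count (p ∖ i)                   ∎
  where
  open ≡-Reasoning
  at : Fin _ → ℕ
  at j = ind (p j ∧ (j == i))
  split : ∀ j → ind (p j) ≡ at j ℕ.+ ind ((p ∖ i) j)
  split j with p j | j == i
  ... | true  | true  = refl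
  ... | true  | false = refl
  ... | false | _     = refl
  off-i : ∀ j → ¬ j ≡ i → at j ≡ 0
  off-i j j≢i = trans (cong (λ b → ind (p j ∧ b)) (T-not⇒≡false (==-≢ j≢i))) (cong ind (∧-zeroʳ (p j)))

ind-T : ∀ {b} → T b → ind b ≡ 1
ind-T {true} _ = refl

count-remove : (p : Fin n → Bool) {i : Fin n} → T (p i) → count p ≡ suc (count (p ∖ i))
count-remove p {i} pi = trans (count-split p i) (cong (ℕ._+ count (p ∖ i)) (ind-T pi))

count-zero : (p : Fin n → Bool) → count p ≡ 0 → ∀ j → ¬ T (p j)
count-zero p c0 j pj with () ← trans (sym (count-remove p pj)) c0

count-witness : (p : Fin n → Bool) {k : ℕ} → count p ≡ suc k → ∃ λ i → T (p i)
count-witness {zero} p ()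
count-witness {suc n} p c with p zero in e
... | true  = zero , subst T (sym e) tt
... | false with count-witness (λ j → p (suc j)) c
...   | i , pi = suc i , pi

peel : (p : Fin n → Bool) {k : ℕ} → count p ≡ suc k → Σ (Fin n) λ i → T (p i) × count (p ∖ i) ≡ k
peel p c with count-witness p c
... | i , pi = i , pi , ℕP.suc-injective (trans (sym (count-remove p pi)) c)

count-unique : (p : Fin n → Bool) → (∀ i j → T (p i) → T (p j) → i ≡ j) → count p ≡ ind (any p (allFin n))
count-unique {n} p unique with any p (allFin n) in e
... | true with satisfied (any⁻ p (allFin _) (subst T (sym e) tt))
...   | i , pi = trans (count-remove p pi) (cong suc (ℕΣ.sum-zero _ none-but-i))
  where
  none-but-i : ∀ j → ind ((p ∖ i) j) ≡ 0
  none-but-i j with (p ∖ i) j in e′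
  ... | false = refl
  ... | true with ∖-sound {p = p} (subst T (sym e′) tt)
  ...   | pj , j≢i = ⊥-elim (j≢i (unique j i pj pi))
count-unique {n} p unique | false = ℕΣ.sum-zero _ no-point
  where
  no-point : ∀ j → ind (p j) ≡ 0
  no-point j with p j in e′
  ... | false = refl
  ... | true = ⊥-elim (subst T e (any⁺ p (Any.map (λ { refl → subst T (sym e′) tt }) (∈-allFin j))))

adj-sym : (G : Graph n) {u w : Fin n} → Adj G u w → Adj G w u
adj-sym G {u} {w} = subst T (Graph.sym G u w)

adj-≢ : (G : Graph n) {u w : Fin n} → Adj G u w → ¬ u ≡ w
adj-≢ G {u} a refl = subst T (Graph.irrefl G u) a

_⊆ᴳ_ : Graph n → Graph n → Set
G ⊆ᴳ H = ∀ {u w} → Adj G u w → Adj H u w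

walk-map : {G H : Graph n} → G ⊆ᴳ H → {a b : Fin n} → Walk G a b → Walk H a b
walk-map G⊆H (here v) = here v
walk-map G⊆H (step e W) = step (G⊆H e) (walk-map G⊆H W)

_++ʷ_ : {G : Graph n} {a b c : Fin n} → Walk G a b → Walk G b c → Walk G a c
here _   ++ʷ W′ = W′
step e W ++ʷ W′ = step e (W ++ʷ W′)

walk-snoc : {G : Graph n} {a b c : Fin n} → Walk G a b → Adj G b c → Walk G a c
walk-snoc W e = W ++ʷ step e (here _)

walk-reverse : (G : Graph n) {a b : Fin n} → Walk G a b → Walk G b a
walk-reverse G (here v) = here v
walk-reverse G (step e W) = walk-snoc (walk-reverse G W) (adj-sym G e)

SameEdge : Fin n → Fin n → Fin n → Fin n → Set
SameEdge p q u w = (u ≡ p × w ≡ q) ⊎ (u ≡ q × w ≡ p)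

isEdge : Fin n → Fin n → Fin n → Fin n → Bool
isEdge p q u w = (u == p ∧ w == q) ∨ (u == q ∧ w == p)

isEdge-sym : (p q u w : Fin n) → isEdge p q u w ≡ isEdge p q w u
isEdge-sym p q u w = trans (∨-comm (u == p ∧ w == q) (u == q ∧ w == p))
  (cong₂ _∨_ (∧-comm (u == q) (w == p)) (∧-comm (u == p) (w == q)))

isEdge-sound : {p q u w : Fin n} → T (isEdge p q u w) → SameEdge p q u w
isEdge-sound t with Equivalence.to T-∨ t
... | inj₁ s = let (a , b) = Equivalence.to T-∧ s in inj₁ (==-sound a , ==-sound b)
... | inj₂ s = let (a , b) = Equivalence.to T-∧ s in inj₂ (==-sound a , ==-sound b)

isEdge-complete : {p q u w : Fin n} → SameEdge p q u w → T (isEdge p q u w)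
isEdge-complete {p = p} {q} (inj₁ (refl , refl)) =
  Equivalence.from (T-∨ {p == p ∧ q == q}) (inj₁ (Equivalence.from (T-∧ {p == p}) (==-refl p , ==-refl q)))
isEdge-complete {p = p} {q} (inj₂ (refl , refl)) =
  Equivalence.from (T-∨ {q == p ∧ p == q}) (inj₂ (Equivalence.from (T-∧ {q == q}) (==-refl q , ==-refl p)))

del : Graph n → Fin n → Fin n → Graph n
del G p q = record
  { adj    = λ u w → adj G u w ∧ not (isEdge p q u w)
  ; sym    = λ u w → cong₂ (λ a b → a ∧ not b) (Graph.sym G u w) (isEdge-sym p q u w)
  ; irrefl = λ v → cong (_∧ not (isEdge p q v v)) (Graph.irrefl G v) }

del-⊆ : (G : Graph n) (p q : Fin n) → del G p q ⊆ᴳ G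
del-⊆ G p q {u} {w} e = proj₁ (Equivalence.to (T-∧ {adj G u w}) e)

del-gone : (G : Graph n) (p q : Fin n) {u w : Fin n} → Adj (del G p q) u w → ¬ SameEdge p q u w
del-gone G p q {u} {w} e s = T-not (proj₂ (Equivalence.to (T-∧ {adj G u w}) e)) (isEdge-complete s)

del-keep : (G : Graph n) (p q : Fin n) {u w : Fin n} → Adj G u w → ¬ SameEdge p q u w → Adj (del G p q) u w
del-keep G p q {u} {w} e ns = Equivalence.from (T-∧ {adj G u w}) (e , subst (λ b → T (not b)) (sym (¬T⇒≡false (ns ∘ isEdge-sound))) tt)

add : (G : Graph n) (p q : Fin n) → ¬ p ≡ q → Graph n
add G p q p≢q = record
  { adj    = λ u w → adj G u w ∨ isEdge p q u w
  ; sym    = λ u w → cong₂ _∨_ (Graph.sym G u w) (isEdge-sym p q u w)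
  ; irrefl = λ v → cong₂ _∨_ (Graph.irrefl G v) (¬T⇒≡false (loop v ∘ isEdge-sound)) }
  where
  loop : ∀ v → ¬ SameEdge p q v v
  loop v (inj₁ (refl , refl)) = p≢q refl
  loop v (inj₂ (refl , refl)) = p≢q refl

add-⊇ : (G : Graph n) (p q : Fin n) (p≢q : ¬ p ≡ q) → G ⊆ᴳ add G p q p≢q
add-⊇ G p q p≢q {u} {w} e = Equivalence.from (T-∨ {adj G u w}) (inj₁ e)

add-new : (G : Graph n) (p q : Fin n) (p≢q : ¬ p ≡ q) → Adj (add G p q p≢q) p q
add-new G p q p≢q = Equivalence.from (T-∨ {adj G p q}) (inj₂ (isEdge-complete {p = p} {q} (inj₁ (refl , refl))))

add-cases : (G : Graph n) (p q : Fin n) (p≢q : ¬ p ≡ q) {u w : Fin n} →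
            Adj (add G p q p≢q) u w → Adj G u w ⊎ SameEdge p q u w
add-cases G p q p≢q {u} {w} e with Equivalence.to (T-∨ {adj G u w}) e
... | inj₁ old = inj₁ old
... | inj₂ new = inj₂ (isEdge-sound new)

acyclic-⊆ : {G H : Graph n} → G ⊆ᴳ H → Acyclic H → Acyclic G
acyclic-⊆ G⊆H acH [] ()
acyclic-⊆ G⊆H acH (c ∷ cs) (len , U , L) = acH (c ∷ cs) (len , U , Linked.map G⊆H L)

data Path (G : Graph n) : Fin n → Fin n → List (Fin n) → Set where
  stop : ∀ v → Path G v v (v ∷ [])
  _∷ᵖ_ : ∀ {u w v l} → Adj G u w → Path G w v l → Path G u v (u ∷ l)

path-suffix : {G : Graph n} {w v u : Fin n} {l : List (Fin n)} → Path G w v l → Unique l → u ∈ l →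
              ∃ λ l′ → Path G u v l′ × Unique l′
path-suffix (stop v) U (here refl) = _ , stop v , U
path-suffix (e ∷ᵖ P) U (here refl) = _ , e ∷ᵖ P , U
path-suffix (e ∷ᵖ P) (_ ∷ U) (there m) = path-suffix P U m

walk⇒path : {G : Graph n} {u v : Fin n} → Walk G u v → ∃ λ l → Path G u v l × Unique l
walk⇒path (here v) = _ , stop v , [] ∷ []
walk⇒path {u = u} (step e W) with walk⇒path W
... | l , P , U with Any.any? (u ≟_) l
...   | yes m = path-suffix P U m
...   | no u∉l = _ , e ∷ᵖ P , ¬Any⇒All¬ l u∉l ∷ U

path-linked : {G H : Graph n} → G ⊆ᴳ H → {a b c : Fin n} {l : List (Fin n)} →
              Path G a b l → Adj H b c → Linked (Adj H) (l ∷ʳ c)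
path-linked G⊆H (stop v) e = e ∷ [-]
path-linked G⊆H (e′ ∷ᵖ stop v) e = G⊆H e′ ∷ e ∷ [-]
path-linked {G = G} {H} G⊆H (e′ ∷ᵖ (e″ ∷ᵖ P)) e = G⊆H e′ ∷ path-linked {G = G} {H} G⊆H (e″ ∷ᵖ P) e

bridge : (G : Graph n) → Acyclic G → {x r : Fin n} → Adj G x r → ¬ Walk (del G x r) r x
bridge G ac {x} {r} e W with walk⇒path W
... | _ , stop _ , _ = adj-≢ G e refl
... | _ , e′ ∷ᵖ stop _ , _ = del-gone G x r e′ (inj₂ (refl , refl))
... | _ , e′ ∷ᵖ (e″ ∷ᵖ P) , U = ac _ (s≤s (nonempty P) , U , path-linked {G = del G x r} {G} (del-⊆ G x r) (e′ ∷ᵖ (e″ ∷ᵖ P)) e)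
  where
  nonempty : ∀ {a b l} → Path (del G x r) a b l → 1 ≤ length l
  nonempty (stop _) = s≤s z≤n
  nonempty (_ ∷ᵖ _) = s≤s z≤n

module _ {A : Set} where
  lastOf : A → List A → A
  lastOf a [] = a
  lastOf a (b ∷ l) = lastOf b l

  lastOf-∷ʳ : (a : A) (l : List A) (z : A) → lastOf a (l ∷ʳ z) ≡ z
  lastOf-∷ʳ a [] z = refl
  lastOf-∷ʳ a (b ∷ l) z = lastOf-∷ʳ b l z

  linked-∷ʳ : {R : A → A → Set} {a z : A} {l : List A} → Linked R (a ∷ l) → R (lastOf a l) z → Linked R ((a ∷ l) ∷ʳ z)
  linked-∷ʳ {l = []} [-] r = r ∷ [-]
  linked-∷ʳ {l = b ∷ l} (r′ ∷ L) r = r′ ∷ linked-∷ʳ L r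

  linked-init : {R : A → A → Set} (l : List A) {z : A} → Linked R (l ∷ʳ z) → Linked R l
  linked-init [] L = []
  linked-init (a ∷ []) L = [-]
  linked-init (a ∷ b ∷ l) (r ∷ L) = r ∷ linked-init (b ∷ l) L

  unique-rotate : {x : A} {xs : List A} → Unique (x ∷ xs) → Unique (xs ∷ʳ x)
  unique-rotate {xs = []} _ = [] ∷ []
  unique-rotate {xs = y ∷ ys} ((x≢y ∷ x∉ys) ∷ (y∉ys ∷ U)) =
    All.∷ʳ⁺ y∉ys (λ y≡x → x≢y (sym y≡x)) ∷ unique-rotate (x∉ys ∷ U)

rotate-once : (H : Graph n) {c₀ c₁ : Fin n} {cs : List (Fin n)} → IsCycle H (c₀ ∷ c₁ ∷ cs) → IsCycle H (c₁ ∷ (cs ∷ʳ c₀))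
rotate-once H {c₀} {c₁} {cs} (len , U , (e ∷ L)) =
  subst (2 ≤_) (sym (trans (length-++ cs) (ℕP.+-comm (length cs) 1))) len ,
  unique-rotate U ,
  linked-∷ʳ L (subst (λ z → Adj H z c₁) (sym (lastOf-∷ʳ c₁ cs c₀)) e)

rotate : (H : Graph n) (pre : List (Fin n)) {a b c₀ : Fin n} {post cs : List (Fin n)} →
         IsCycle H (c₀ ∷ cs) → (c₀ ∷ cs) ∷ʳ c₀ ≡ pre ++ a ∷ b ∷ post →
         ∃ λ mid → IsCycle H (b ∷ (mid ∷ʳ a))
rotate H pre {cs = []} (() , _) _
rotate H [] {cs = c₁ ∷ cs} C refl = cs , rotate-once H C
rotate H (_ ∷ pre) {a} {b} {post = post} {c₁ ∷ cs} C eq =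
  rotate H pre {post = post ∷ʳ c₁} (rotate-once H C)
    (trans (cong (_∷ʳ c₁) (∷-injectiveʳ eq)) (++-assoc pre (a ∷ b ∷ post) (c₁ ∷ [])))

walk-along : (G : Graph n) (p q : Fin n) {a : Fin n} {l : List (Fin n)} →
             Linked (Adj G) (a ∷ l) → All (λ z → ¬ z ≡ p) (a ∷ l) → Walk (del G p q) a (lastOf a l)
walk-along G p q {l = []} _ _ = here _
walk-along G p q {l = b ∷ l} (e ∷ L) (a≢p ∷ b≢p ∷ bs) =
  step (del-keep G p q e λ { (inj₁ (a≡p , _)) → a≢p a≡p ; (inj₂ (_ , b≡p)) → b≢p b≡p })
       (walk-along G p q L (b≢p ∷ bs))

cycle-detour : (H : Graph n) {b a : Fin n} {mid : List (Fin n)} → IsCycle H (b ∷ (mid ∷ʳ a)) → Walk (del H b a) b a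
cycle-detour H {mid = []} (s≤s () , _)
cycle-detour H {b} {a} {m ∷ mid} (_ , (b∉ ∷ (m∉ ∷ _)) , (e ∷ L)) =
  step (del-keep H b a e λ { (inj₁ (_ , m≡a)) → proj₂ (All.∷ʳ⁻ {xs = mid} m∉) m≡a
                          ; (inj₂ (b≡a , _)) → proj₂ (All.∷ʳ⁻ {xs = m ∷ mid} b∉) b≡a })
       (subst (Walk (del H b a) m) (lastOf-∷ʳ m mid a)
              (walk-along H b a (linked-init (m ∷ (mid ∷ʳ a)) L) (All.map (λ b≢z z≡b → b≢z (sym z≡b)) b∉)))

split-new-edge : (G : Graph n) (p q : Fin n) (p≢q : ¬ p ≡ q) (L : List (Fin n)) → Linked (Adj (add G p q p≢q)) L →
  Linked (Adj G) L ⊎ ∃ λ pre → ∃ λ a → ∃ λ b → ∃ λ post → L ≡ pre ++ a ∷ b ∷ post × SameEdge p q a b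
split-new-edge G p q p≢q [] _ = inj₁ []
split-new-edge G p q p≢q (a ∷ []) _ = inj₁ [-]
split-new-edge G p q p≢q (a ∷ b ∷ l) (e ∷ L) with add-cases G p q p≢q e
... | inj₂ new = inj₂ ([] , a , b , l , refl , new)
... | inj₁ old with split-new-edge G p q p≢q (b ∷ l) L
...   | inj₁ L′ = inj₁ (old ∷ L′)
...   | inj₂ (pre , a′ , b′ , post , eq , new) = inj₂ (a ∷ pre , a′ , b′ , post , cong (a ∷_) eq , new)

add-acyclic : (G : Graph n) (p q : Fin n) (p≢q : ¬ p ≡ q) → Acyclic G → ¬ Walk G p q → Acyclic (add G p q p≢q)
add-acyclic G p q p≢q acG apart [] ()
add-acyclic G p q p≢q acG apart (c₀ ∷ cs) C@(len , U , L) with split-new-edge G p q p≢q _ L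
... | inj₁ L′ = acG (c₀ ∷ cs) (len , U , L′)
... | inj₂ (pre , a , b , post , eq , new) with rotate (add G p q p≢q) pre C eq
...   | mid , C′ = joined new (walk-map old-edge (cycle-detour H C′))
  where
  H : Graph _
  H = add G p q p≢q
  old-edge : del H b a ⊆ᴳ G
  old-edge e with add-cases G p q p≢q (del-⊆ H b a e)
  ... | inj₁ old = old
  ... | inj₂ new′ = ⊥-elim (del-gone H b a e (flip new new′))
    where
    flip : ∀ {u w} → SameEdge p q a b → SameEdge p q u w → SameEdge b a u w
    flip (inj₁ (refl , refl)) (inj₁ (refl , refl)) = inj₂ (refl , refl)
    flip (inj₁ (refl , refl)) (inj₂ (refl , refl)) = inj₁ (refl , refl)
    flip (inj₂ (refl , refl)) (inj₁ (refl , refl)) = inj₁ (refl , refl)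
    flip (inj₂ (refl , refl)) (inj₂ (refl , refl)) = inj₂ (refl , refl)
  joined : SameEdge p q a b → Walk G b a → ⊥
  joined (inj₁ (refl , refl)) W = apart (walk-reverse G W)
  joined (inj₂ (refl , refl)) W = apart W

isolate : Graph n → Fin n → Graph n
isolate G x = record
  { adj    = λ u w → adj G u w ∧ not (u == x) ∧ not (w == x)
  ; sym    = λ u w → cong₂ _∧_ (Graph.sym G u w) (∧-comm (not (u == x)) (not (w == x)))
  ; irrefl = λ v → cong (_∧ (not (v == x) ∧ not (v == x))) (Graph.irrefl G v) }

isolate-keep : (G : Graph n) {x u w : Fin n} → Adj G u w → ¬ u ≡ x → ¬ w ≡ x → Adj (isolate G x) u w
isolate-keep G {u = u} {w} e u≢x w≢x =
  Equivalence.from (T-∧ {adj G u w}) (e , Equivalence.from (T-∧ {not (u == _)}) (==-≢ u≢x , ==-≢ w≢x))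

isolate-⊆-del : (G : Graph n) (x q : Fin n) → isolate G x ⊆ᴳ del G x q
isolate-⊆-del G x q {u} {w} e with Equivalence.to (T-∧ {adj G u w}) e
... | uw , rest with Equivalence.to (T-∧ {not (u == x)}) rest
...   | u≢x , w≢x = del-keep G x q uw λ { (inj₁ (u≡x , _)) → T-not u≢x (fromWitness u≡x)
                                        ; (inj₂ (_ , w≡x)) → T-not w≢x (fromWitness w≡x) }

avoid-vertex : (G : Graph n) (x q : Fin n) {s t : Fin n} → ¬ Walk (del G x q) s x → Walk (del G x q) s t → Walk (isolate G x) s t
avoid-vertex G x q away (here _) = here _
avoid-vertex G x q {s} away (step e W) =
  step (isolate-keep G (del-⊆ G x q e) (λ { refl → away (here _) }) (λ { refl → away (step e (here _)) }))
       (avoid-vertex G x q (away ∘ step e) W)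

other-side : (G : Graph n) → Acyclic G → {x r t : Fin n} → Adj G x r → Adj G x t → ¬ r ≡ t → ¬ Walk (del G x r) r t
other-side G ac {x} {r} {t} xr xt r≢t W = bridge G ac xr (walk-snoc W tx)
  where
  tx : Adj (del G x r) t x
  tx = del-keep G x r (adj-sym G xt) λ { (inj₁ (t≡x , _)) → adj-≢ G xt (sym t≡x) ; (inj₂ (t≡r , _)) → r≢t (sym t≡r) }

one-branch : (G : Graph n) → Acyclic G → {x a b t : Fin n} → Adj G x a → Adj G x b → ¬ a ≡ b →
             Walk (del G x a) a t → Walk (del G x b) b t → ⊥
one-branch G ac {x} {a} {b} xa xb a≢b Wa Wb = bridge G ac xa (walk-snoc a⇝b bx)
  where
  a⇝b : Walk (del G x a) a b
  a⇝b = walk-map (isolate-⊆-del G x a)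
          (avoid-vertex G x a (bridge G ac xa) Wa ++ʷ walk-reverse (isolate G x) (avoid-vertex G x b (bridge G ac xb) Wb))
  bx : Adj (del G x a) b x
  bx = del-keep G x a (adj-sym G xb) λ { (inj₁ (b≡x , _)) → adj-≢ G xb (sym b≡x) ; (inj₂ (b≡a , _)) → a≢b (sym b≡a) }

branch-avoiding : (G : Graph n) → Acyclic G → {x a b t : Fin n} → Adj G x a → Adj G x b → ¬ a ≡ b →
                  ({r : Fin n} → Adj G x r → ¬ Walk (del G x r) r t → ⊥) → ⊥
branch-avoiding G ac xa xb a≢b K = K xa λ Wa → K xb λ Wb → one-branch G ac xa xb a≢b Wa Wb

deg-count : (G : Graph n) (v : Fin n) → deg G v ≡ count (adj G v)
deg-count G v = listSum-allFin (λ w → ind (adj G v w))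

τ-count : (G : Graph n) (v : Fin n) → τ G v ≡ count (dist2 G v)
τ-count G v = listSum-allFin (λ w → ind (dist2 G v w))

no-triangle : (G : Graph n) → Acyclic G → {v u w : Fin n} → Adj G v u → Adj G u w → ¬ Adj G v w
no-triangle G ac vu uw vw = ac (_ ∷ _ ∷ _ ∷ [])
  (s≤s (s≤s z≤n) ,
   ((adj-≢ G vu ∷ adj-≢ G vw ∷ []) ∷ (adj-≢ G uw ∷ []) ∷ [] ∷ []) ,
   (vu ∷ uw ∷ adj-sym G vw ∷ [-]))

no-square : (G : Graph n) → Acyclic G → {v u₁ w u₂ : Fin n} → Adj G v u₁ → Adj G u₁ w → Adj G v u₂ → Adj G u₂ w →
            ¬ v ≡ w → u₁ ≡ u₂
no-square G ac {u₁ = u₁} {u₂ = u₂} vu₁ u₁w vu₂ u₂w v≢w with u₁ ≟ u₂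
... | yes u₁≡u₂ = u₁≡u₂
... | no u₁≢u₂ = ⊥-elim (ac (_ ∷ _ ∷ _ ∷ _ ∷ [])
  (s≤s (s≤s z≤n) ,
   ((adj-≢ G vu₁ ∷ v≢w ∷ adj-≢ G vu₂ ∷ []) ∷
    (adj-≢ G u₁w ∷ u₁≢u₂ ∷ []) ∷
    ((λ w≡u₂ → adj-≢ G u₂w (sym w≡u₂)) ∷ []) ∷ [] ∷ []) ,
   (vu₁ ∷ u₁w ∷ adj-sym G u₂w ∷ adj-sym G vu₂ ∷ [-])))

common : (G : Graph n) → Fin n → Fin n → ℕ
common G v w = count (λ u → adj G v u ∧ adj G u w)

common-neighbours : (G : Graph n) → Acyclic G → (v w : Fin n) →
                    common G v w ≡ (if w == v then deg G v else 0) ℕ.+ ind (dist2 G v w)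
common-neighbours G ac v w with w ≟ v
... | yes refl rewrite T⇒≡true (==-refl v) =
  trans (ℕΣ.sum-cong-≗ (λ u → cong ind (trans (cong (adj G v u ∧_) (Graph.sym G u v)) (∧-idem (adj G v u)))))
        (trans (sym (deg-count G v)) (sym (ℕP.+-identityʳ _)))
... | no w≢v rewrite T-not⇒≡false (==-≢ (w≢v ∘ sym)) with adj G v w in vw
...   | true = ℕΣ.sum-zero _ no-common
  where
  no-common : ∀ u → ind (adj G v u ∧ adj G u w) ≡ 0
  no-common u with adj G v u in vu | adj G u w in uw
  ... | true  | true  = ⊥-elim (no-triangle G ac (≡true⇒T vu) (≡true⇒T uw) (≡true⇒T vw))
  ... | true  | false = refl
  ... | false | _     = refl
...   | false = count-unique _ λ i j vij vjj →
  let (vi , iw) = Equivalence.to (T-∧ {adj G v i}) vij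
      (vj , jw) = Equivalence.to (T-∧ {adj G v j}) vjj
  in no-square G ac vi iw vj jw (w≢v ∘ sym)

neighbour-degrees : (G : Graph n) → Fin n → ℕ
neighbour-degrees G v = ℕΣ.sum (λ u → ind (adj G v u) ℕ.* deg G u)

ind-∧ : (a b : Bool) → ind a ℕ.* ind b ≡ ind (a ∧ b)
ind-∧ true  b = ℕP.+-identityʳ (ind b)
ind-∧ false b = refl

τ-lemma : (G : Graph n) → Acyclic G → (v : Fin n) → deg G v ℕ.+ τ G v ≡ neighbour-degrees G v
τ-lemma G ac v = sym (begin
  ℕΣ.sum (λ u → ind (adj G v u) ℕ.* deg G u)
    ≡⟨ ℕΣ.sum-cong-≗ (λ u → trans (cong (ind (adj G v u) ℕ.*_) (deg-count G u)) (paths u)) ⟩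
  ℕΣ.sum (λ u → ℕΣ.sum (λ w → ind (adj G v u ∧ adj G u w)))
    ≡⟨ ℕΣ.∑-comm (λ u w → ind (adj G v u ∧ adj G u w)) ⟩
  ℕΣ.sum (common G v)
    ≡⟨ ℕΣ.sum-cong-≗ (common-neighbours G ac v) ⟩
  ℕΣ.sum (λ w → (if w == v then deg G v else 0) ℕ.+ ind (dist2 G v w))
    ≡⟨ ℕΣ.∑-distrib-+ (λ w → if w == v then deg G v else 0) (λ w → ind (dist2 G v w)) ⟩
  ℕΣ.sum (λ w → if w == v then deg G v else 0) ℕ.+ count (dist2 G v)
    ≡⟨ cong₂ ℕ._+_ (ℕΣ.sum-single _ v off-v) (sym (τ-count G v)) ⟩
  (if v == v then deg G v else 0) ℕ.+ τ G v
    ≡⟨ cong (λ b → (if b then deg G v else 0) ℕ.+ τ G v) (T⇒≡true (==-refl v)) ⟩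
  deg G v ℕ.+ τ G v ∎)
  where
  open ≡-Reasoning
  paths : ∀ u → ind (adj G v u) ℕ.* count (adj G u) ≡ ℕΣ.sum (λ w → ind (adj G v u ∧ adj G u w))
  paths u = trans (ℕΣ.*-distribˡ-sum (ind (adj G v u)) (λ w → ind (adj G u w))) (ℕΣ.sum-cong-≗ (λ w → ind-∧ (adj G v u) (adj G u w)))
  off-v : ∀ w → ¬ w ≡ v → (if w == v then deg G v else 0) ≡ 0
  off-v w w≢v rewrite T-not⇒≡false (==-≢ w≢v) = refl

-- ZC₁* = Σ_v d_v S_v − Σ_v d_v² for acyclic graphs, stated additively in ℕ.
ZC-identity : (G : Graph n) → Acyclic G →
  ZC₁* G ℕ.+ ℕΣ.sum (λ v → deg G v ℕ.* deg G v) ≡ ℕΣ.sum (λ v → deg G v ℕ.* neighbour-degrees G v)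
ZC-identity G ac = begin
  ZC₁* G ℕ.+ ℕΣ.sum (λ v → deg G v ℕ.* deg G v)
    ≡⟨ cong (ℕ._+ ℕΣ.sum (λ v → deg G v ℕ.* deg G v)) (listSum-allFin (λ v → deg G v ℕ.* τ G v)) ⟩
  ℕΣ.sum (λ v → deg G v ℕ.* τ G v) ℕ.+ ℕΣ.sum (λ v → deg G v ℕ.* deg G v)
    ≡⟨ sym (ℕΣ.∑-distrib-+ (λ v → deg G v ℕ.* τ G v) (λ v → deg G v ℕ.* deg G v)) ⟩
  ℕΣ.sum (λ v → deg G v ℕ.* τ G v ℕ.+ deg G v ℕ.* deg G v)
    ≡⟨ ℕΣ.sum-cong-≗ per-vertex ⟩
  ℕΣ.sum (λ v → deg G v ℕ.* neighbour-degrees G v) ∎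
  where
  open ≡-Reasoning
  per-vertex : ∀ v → deg G v ℕ.* τ G v ℕ.+ deg G v ℕ.* deg G v ≡ deg G v ℕ.* neighbour-degrees G v
  per-vertex v = trans (sym (ℕP.*-distribˡ-+ (deg G v) (τ G v) (deg G v)))
                       (cong (deg G v ℕ.*_) (trans (ℕP.+-comm (τ G v) (deg G v)) (τ-lemma G ac v)))

Matrix : ℕ → Set
Matrix n = Fin n → Fin n → ℤ

_·_ : Vector ℤ n → Vector ℤ n → ℤ
f · g = ℤΣ.sum (λ i → f i * g i)

_▷_ : Matrix n → Vector ℤ n → Vector ℤ n
(M ▷ f) i = M i · f

δ : Fin n → Vector ℤ n
δ a i = + ind (i == a)

δ-self : (a : Fin n) → δ a a ≡ + 1
δ-self a rewrite T⇒≡true (==-refl a) = refl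

δ-other : {a i : Fin n} → ¬ i ≡ a → δ a i ≡ + 0
δ-other i≢a rewrite T-not⇒≡false (==-≢ i≢a) = refl

∑-neg : (f : Vector ℤ n) → ℤΣ.sum (λ i → - f i) ≡ - ℤΣ.sum f
∑-neg {zero} f = refl
∑-neg {suc n} f = trans (cong (λ t → - f zero + t) (∑-neg (λ i → f (suc i)))) (sym (ℤP.neg-distrib-+ (f zero) _))

∑-distrib-- : (f g : Vector ℤ n) → ℤΣ.sum (λ i → f i - g i) ≡ ℤΣ.sum f - ℤΣ.sum g
∑-distrib-- f g = trans (ℤΣ.∑-distrib-+ f (λ i → - g i)) (cong (λ t → ℤΣ.sum f + t) (∑-neg g))

·-comm : (f g : Vector ℤ n) → f · g ≡ g · f
·-comm f g = ℤΣ.sum-cong-≗ (λ i → ℤP.*-comm (f i) (g i))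

·-+ʳ : (f g h : Vector ℤ n) → f · (λ i → g i + h i) ≡ f · g + f · h
·-+ʳ f g h = trans (ℤΣ.sum-cong-≗ (λ i → ℤP.*-distribˡ-+ (f i) (g i) (h i))) (ℤΣ.∑-distrib-+ (λ i → f i * g i) (λ i → f i * h i))

·--ʳ : (f g h : Vector ℤ n) → f · (λ i → g i - h i) ≡ f · g - f · h
·--ʳ f g h = trans (ℤΣ.sum-cong-≗ (λ i → distrib (f i) (g i) (h i))) (∑-distrib-- (λ i → f i * g i) (λ i → f i * h i))
  where
  distrib : ∀ a b c → a * (b - c) ≡ a * b - a * c
  distrib = solve-∀

·-*ʳ : (f : Vector ℤ n) (c : ℤ) (g : Vector ℤ n) → f · (λ i → c * g i) ≡ c * (f · g)
·-*ʳ f c g = trans (ℤΣ.sum-cong-≗ (λ i → lem (f i) c (g i))) (sym (ℤΣ.*-distribˡ-sum c (λ i → f i * g i)))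
  where
  lem : ∀ a b c → a * (b * c) ≡ b * (a * c)
  lem = solve-∀

·-δ : (f : Vector ℤ n) (a : Fin n) → f · δ a ≡ f a
·-δ f a = trans (ℤΣ.sum-single _ a (λ i i≢a → trans (cong (f i *_) (δ-other i≢a)) (ℤP.*-zeroʳ (f i))))
                (trans (cong (f a *_) (δ-self a)) (ℤP.*-identityʳ (f a)))

shift : Fin n → Fin n → Vector ℤ n → Vector ℤ n
shift x y f i = f i - δ x i + δ y i

·-shift : (f : Vector ℤ n) (x y : Fin n) (g : Vector ℤ n) → f · shift x y g ≡ f · g - f x + f y
·-shift f x y g = begin
  f · shift x y g                    ≡⟨ ·-+ʳ f (λ i → g i - δ x i) (δ y) ⟩
  f · (λ i → g i - δ x i) + f · δ y  ≡⟨ cong₂ _+_ (·--ʳ f g (δ x)) (·-δ f y) ⟩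
  f · g - f · δ x + f y              ≡⟨ cong (λ t → f · g - t + f y) (·-δ f x) ⟩
  f · g - f x + f y                  ∎
  where open ≡-Reasoning

E : Fin n → Fin n → Matrix n
E a b i j = δ a i * δ b j + δ b i * δ a j

E▷ : (a b : Fin n) (g : Vector ℤ n) (i : Fin n) → (E a b ▷ g) i ≡ δ a i * g b + δ b i * g a
E▷ a b g i = begin
  ℤΣ.sum (λ j → (δ a i * δ b j + δ b i * δ a j) * g j)
    ≡⟨ ℤΣ.sum-cong-≗ (λ j → lem (δ a i) (δ b j) (δ b i) (δ a j) (g j)) ⟩
  g · (λ j → δ a i * δ b j + δ b i * δ a j)
    ≡⟨ ·-+ʳ g (λ j → δ a i * δ b j) (λ j → δ b i * δ a j) ⟩
  g · (λ j → δ a i * δ b j) + g · (λ j → δ b i * δ a j)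
    ≡⟨ cong₂ _+_ (·-*ʳ g (δ a i) (δ b)) (·-*ʳ g (δ b i) (δ a)) ⟩
  δ a i * (g · δ b) + δ b i * (g · δ a)
    ≡⟨ cong₂ (λ s t → δ a i * s + δ b i * t) (·-δ g b) (·-δ g a) ⟩
  δ a i * g b + δ b i * g a ∎
  where
  open ≡-Reasoning
  lem : ∀ p q r s t → (p * q + r * s) * t ≡ t * (p * q + r * s)
  lem = solve-∀

·-E▷ : (f : Vector ℤ n) (a b : Fin n) (g : Vector ℤ n) → f · (E a b ▷ g) ≡ f a * g b + f b * g a
·-E▷ f a b g = begin
  f · (E a b ▷ g)                                   ≡⟨ ℤΣ.sum-cong-≗ (λ i → cong (f i *_) (E▷ a b g i)) ⟩
  f · (λ i → δ a i * g b + δ b i * g a)             ≡⟨ ·-+ʳ f (λ i → δ a i * g b) (λ i → δ b i * g a) ⟩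
  f · (λ i → δ a i * g b) + f · (λ i → δ b i * g a) ≡⟨ cong₂ _+_ (comm-scale (δ a) (g b)) (comm-scale (δ b) (g a)) ⟩
  g b * (f · δ a) + g a * (f · δ b)                 ≡⟨ cong₂ (λ s t → g b * s + g a * t) (·-δ f a) (·-δ f b) ⟩
  g b * f a + g a * f b                             ≡⟨ cong₂ _+_ (ℤP.*-comm (g b) (f a)) (ℤP.*-comm (g a) (f b)) ⟩
  f a * g b + f b * g a                             ∎
  where
  open ≡-Reasoning
  comm-scale : ∀ h c → f · (λ i → h i * c) ≡ c * (f · h)
  comm-scale h c = trans (ℤΣ.sum-cong-≗ (λ i → cong (f i *_) (ℤP.*-comm (h i) c))) (·-*ʳ f c h)

shift-at-x : {x y : Fin n} → ¬ x ≡ y → (f : Vector ℤ n) → shift x y f x ≡ f x - + 1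
shift-at-x {x = x} x≢y f = trans (cong₂ (λ s t → f x - s + t) (δ-self x) (δ-other x≢y)) (ℤP.+-identityʳ (f x - + 1))

shift-at-y : {x y : Fin n} → ¬ x ≡ y → (f : Vector ℤ n) → shift x y f y ≡ f y + + 1
shift-at-y {y = y} x≢y f = trans (cong₂ (λ s t → f y - s + t) (δ-other (x≢y ∘ sym)) (δ-self y)) (cong (_+ + 1) (ℤP.+-identityʳ (f y)))

shift-elsewhere : {x y i : Fin n} → ¬ i ≡ x → ¬ i ≡ y → (f : Vector ℤ n) → shift x y f i ≡ f i
shift-elsewhere {i = i} i≢x i≢y f = trans (cong₂ (λ s t → f i - s + t) (δ-other i≢x) (δ-other i≢y))
                                          (trans (ℤP.+-identityʳ (f i - + 0)) (ℤP.+-identityʳ (f i)))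

E-row-sum : (a b i : Fin n) → ℤΣ.sum (E a b i) ≡ δ a i + δ b i
E-row-sum a b i = begin
  ℤΣ.sum (E a b i)                       ≡⟨ ℤΣ.sum-cong-≗ (λ j → sym (ℤP.*-identityʳ (E a b i j))) ⟩
  (E a b ▷ (λ _ → + 1)) i                ≡⟨ E▷ a b (λ _ → + 1) i ⟩
  δ a i * + 1 + δ b i * + 1              ≡⟨ cong₂ _+_ (ℤP.*-identityʳ (δ a i)) (ℤP.*-identityʳ (δ b i)) ⟩
  δ a i + δ b i                          ∎
  where open ≡-Reasoning

shift-square : {x y : Fin n} → ¬ x ≡ y → (f : Vector ℤ n) →
               shift x y f · shift x y f ≡ f · f + + 2 * (f y - f x) + + 2
shift-square {x = x} {y} x≢y f = begin
  f′ · f′                          ≡⟨ ·-shift f′ x y f ⟩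
  f′ · f - f′ x + f′ y             ≡⟨ cong₂ (λ s t → s - f′ x + t) (·-comm f′ f) (shift-at-y x≢y f) ⟩
  f · f′ - f′ x + (f y + + 1)      ≡⟨ cong₂ (λ s t → s - t + (f y + + 1)) (·-shift f x y f) (shift-at-x x≢y f) ⟩
  f · f - f x + f y - (f x - + 1) + (f y + + 1) ≡⟨ ring (f · f) (f x) (f y) ⟩
  f · f + + 2 * (f y - f x) + + 2  ∎
  where
  open ≡-Reasoning
  f′ = shift x y f
  ring : ∀ s a b → s - a + b - (a - + 1) + (b + + 1) ≡ s + + 2 * (b - a) + + 2
  ring = solve-∀

E▷-at-first : {a b : Fin n} → ¬ a ≡ b → (g : Vector ℤ n) → (E a b ▷ g) a ≡ g b
E▷-at-first {a = a} {b} a≢b g = begin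
  (E a b ▷ g) a               ≡⟨ E▷ a b g a ⟩
  δ a a * g b + δ b a * g a   ≡⟨ cong₂ (λ s t → s * g b + t * g a) (δ-self a) (δ-other a≢b) ⟩
  + 1 * g b + + 0 * g a       ≡⟨ unit (g b) (g a) ⟩
  g b                         ∎
  where
  open ≡-Reasoning
  unit : ∀ s t → + 1 * s + + 0 * t ≡ s
  unit = solve-∀

E▷-at-second : {a b : Fin n} → ¬ a ≡ b → (g : Vector ℤ n) → (E a b ▷ g) b ≡ g a
E▷-at-second {a = a} {b} a≢b g = begin
  (E a b ▷ g) b               ≡⟨ E▷ a b g b ⟩
  δ a b * g b + δ b b * g a   ≡⟨ cong₂ (λ s t → s * g b + t * g a) (δ-other (a≢b ∘ sym)) (δ-self b) ⟩
  + 0 * g b + + 1 * g a       ≡⟨ unit (g b) (g a) ⟩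
  g a                         ∎
  where
  open ≡-Reasoning
  unit : ∀ s t → + 0 * s + + 1 * t ≡ t
  unit = solve-∀

E▷-elsewhere : {a b i : Fin n} → ¬ i ≡ a → ¬ i ≡ b → (g : Vector ℤ n) → (E a b ▷ g) i ≡ + 0
E▷-elsewhere {a = a} {b} {i} i≢a i≢b g = begin
  (E a b ▷ g) i               ≡⟨ E▷ a b g i ⟩
  δ a i * g b + δ b i * g a   ≡⟨ cong₂ (λ s t → s * g b + t * g a) (δ-other i≢a) (δ-other i≢b) ⟩
  + 0 * g b + + 0 * g a       ≡⟨ vanish (g b) (g a) ⟩
  + 0                         ∎
  where
  open ≡-Reasoning
  vanish : ∀ s t → + 0 * s + + 0 * t ≡ + 0
  vanish = solve-∀

·-combine : (f a b c e h : Vector ℤ n) →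
            f · (λ i → a i - b i + c i - e i + h i) ≡ f · a - f · b + f · c - f · e + f · h
·-combine f a b c e h = begin
  f · (λ i → a i - b i + c i - e i + h i)       ≡⟨ ·-+ʳ f (λ i → a i - b i + c i - e i) h ⟩
  f · (λ i → a i - b i + c i - e i) + f · h     ≡⟨ cong (_+ f · h) (·--ʳ f (λ i → a i - b i + c i) e) ⟩
  f · (λ i → a i - b i + c i) - f · e + f · h   ≡⟨ cong (λ t → t - f · e + f · h) (·-+ʳ f (λ i → a i - b i) c) ⟩
  f · (λ i → a i - b i) + f · c - f · e + f · h ≡⟨ cong (λ t → t + f · c - f · e + f · h) (·--ʳ f a b) ⟩
  f · a - f · b + f · c - f · e + f · h         ∎
  where open ≡-Reasoning

A : Graph n → Matrix n
A G i j = + ind (adj G i j)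

degs : Graph n → Vector ℤ n
degs G i = + deg G i

A-sym : (G : Graph n) (i j : Fin n) → A G i j ≡ A G j i
A-sym G i j = cong (+_ ∘ ind) (Graph.sym G i j)

A-irrefl : (G : Graph n) (i : Fin n) → A G i i ≡ + 0
A-irrefl G i = cong (+_ ∘ ind) (Graph.irrefl G i)

+-sum : (f : Fin n → ℕ) → + ℕΣ.sum f ≡ ℤΣ.sum (λ i → + f i)
+-sum {zero} f = refl
+-sum {suc n} f = trans (ℤP.pos-+ (f zero) _) (cong (λ t → + f zero + t) (+-sum (λ i → f (suc i))))

degree-row : (G : Graph n) (i : Fin n) → degs G i ≡ ℤΣ.sum (A G i)
degree-row G i = trans (cong +_ (deg-count G i)) (+-sum (λ j → ind (adj G i j)))

A▷degs : (G : Graph n) (i : Fin n) → (A G ▷ degs G) i ≡ + neighbour-degrees G i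
A▷degs G i = sym (trans (+-sum (λ u → ind (adj G i u) ℕ.* deg G u)) (ℤΣ.sum-cong-≗ λ u →
  ℤP.pos-* (ind (adj G i u)) (deg G u)))

ZC-quadratic : (G : Graph n) → Acyclic G → + ZC₁* G ≡ degs G · (A G ▷ degs G) - degs G · degs G
ZC-quadratic G ac = begin
  + ZC₁* G                                                 ≡⟨ add-sub (+ ZC₁* G) (+ M) ⟩
  (+ ZC₁* G + + M) - + M                                   ≡⟨ cong (_- + M) (sym (ℤP.pos-+ (ZC₁* G) M)) ⟩
  + (ZC₁* G ℕ.+ M) - + M                                   ≡⟨ cong (λ t → + t - + M) (ZC-identity G ac) ⟩
  + ℕΣ.sum (λ v → deg G v ℕ.* neighbour-degrees G v) - + M ≡⟨ cong₂ _-_ (cast (neighbour-degrees G) (A▷degs G)) (cast (deg G) (λ _ → refl)) ⟩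
  degs G · (A G ▷ degs G) - degs G · degs G               ∎
  where
  open ≡-Reasoning
  M = ℕΣ.sum (λ v → deg G v ℕ.* deg G v)
  add-sub : ∀ a b → a ≡ (a + b) - b
  add-sub = solve-∀
  cast : (g : Fin _ → ℕ) {h : Vector ℤ _} → (∀ v → h v ≡ + g v) → + ℕΣ.sum (λ v → deg G v ℕ.* g v) ≡ degs G · h
  cast g h≡g = trans (+-sum (λ v → deg G v ℕ.* g v)) (ℤΣ.sum-cong-≗ λ v → trans (ℤP.pos-* (deg G v) (g v)) (cong (degs G v *_) (sym (h≡g v))))

ind-∧-not : (a b : Bool) → (T b → T a) → + ind (a ∧ not b) ≡ + ind a - + ind b
ind-∧-not true  true  _   = refl
ind-∧-not true  false _   = refl
ind-∧-not false true  b⇒a = ⊥-elim (b⇒a tt)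
ind-∧-not false false _   = refl

ind-∨ : (a b : Bool) → ¬ (T a × T b) → + ind (a ∨ b) ≡ + ind a + + ind b
ind-∨ true  true  both = ⊥-elim (both (tt , tt))
ind-∨ true  false _    = refl
ind-∨ false true  _    = refl
ind-∨ false false _    = refl

δδ-off : {p q i j : Fin n} → ¬ (i ≡ p × j ≡ q) → δ p i * δ q j ≡ + 0
δδ-off {p = p} {q} {i} {j} ne with i ≟ p | j ≟ q
... | no _     | _        = ℤP.*-zeroˡ (δ q j)
... | yes refl | no _     = ℤP.*-zeroʳ (+ 1)
... | yes refl | yes refl = ⊥-elim (ne (refl , refl))

isEdge-E : {p q : Fin n} → ¬ p ≡ q → (i j : Fin n) → + ind (isEdge p q i j) ≡ E p q i j
isEdge-E {p = p} {q} p≢q i j with T? (isEdge p q i j)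
... | no ns = trans (cong (+_ ∘ ind) (¬T⇒≡false ns))
                    (sym (cong₂ _+_ (δδ-off {p = p} {q} {i} {j} λ { (refl , refl) → ns (isEdge-complete {p = p} {q} (inj₁ (refl , refl))) })
                                    (δδ-off {p = q} {p} {i} {j} λ { (refl , refl) → ns (isEdge-complete {p = p} {q} (inj₂ (refl , refl))) })))
... | yes s rewrite T⇒≡true s with isEdge-sound {p = p} {q} {i} {j} s
...   | inj₁ (refl , refl) = sym (cong₂ _+_ (cong₂ _*_ (δ-self p) (δ-self q)) (δδ-off {p = q} {p} {p} {q} (p≢q ∘ proj₁)))
...   | inj₂ (refl , refl) = sym (cong₂ _+_ (δδ-off {p = p} {q} {q} {p} (p≢q ∘ sym ∘ proj₁)) (cong₂ _*_ (δ-self q) (δ-self p)))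

A-del : (G : Graph n) {p q : Fin n} → Adj G p q → (i j : Fin n) → A (del G p q) i j ≡ A G i j - E p q i j
A-del G {p} {q} pq i j = trans (ind-∧-not (adj G i j) (isEdge p q i j) on-edge) (cong (λ t → A G i j - t) (isEdge-E (adj-≢ G pq) i j))
  where
  on-edge : T (isEdge p q i j) → T (adj G i j)
  on-edge s with isEdge-sound {p = p} {q} {i} {j} s
  ... | inj₁ (refl , refl) = pq
  ... | inj₂ (refl , refl) = adj-sym G pq

A-add : (G : Graph n) {p q : Fin n} (p≢q : ¬ p ≡ q) → ¬ Adj G p q → (i j : Fin n) → A (add G p q p≢q) i j ≡ A G i j + E p q i j
A-add G {p} {q} p≢q ¬pq i j = trans (ind-∨ (adj G i j) (isEdge p q i j) not-both) (cong (λ t → A G i j + t) (isEdge-E p≢q i j))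
  where
  not-both : ¬ (T (adj G i j) × T (isEdge p q i j))
  not-both (ij , s) with isEdge-sound {p = p} {q} {i} {j} s
  ... | inj₁ (refl , refl) = ¬pq ij
  ... | inj₂ (refl , refl) = ¬pq (adj-sym G ij)

move-gain : Graph n → (x y r : Fin n) → ℤ
move-gain G x y r = + 2 * (S y - S x) - + 2 * A G x y + + 2 * d r * (d y - d x + + 2) - + 2 * (d y - d x + + 1)
  where
  d S : Vector ℤ _
  d = degs G
  S = A G ▷ d

-- Branch moves.  Let x–r be an edge of G and y a vertex outside the branch
-- at r, i.e. not reachable from r in G − xr.  Replacing the edge xr by ry
-- moves the branch from x to y.
module BranchMove (G : Graph n) {x r y : Fin n} (xr : Adj G x r) (outside : ¬ Walk (del G x r) r y) (x≢y : ¬ x ≡ y) where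

  r≢y : ¬ r ≡ y
  r≢y refl = outside (here r)

  rest : Graph n
  rest = del G x r

  moved : Graph n
  moved = add rest r y r≢y

  outside-reaches-x : {s : Fin n} → ¬ Walk rest r s → Walk G s x → Walk rest s x
  outside-reaches-x out (here _) = here _
  outside-reaches-x {s} out (step e W) with s ≟ x | s ≟ r
  ... | yes refl | _ = here _
  ... | no _ | yes refl = ⊥-elim (out (here _))
  ... | no s≢x | no s≢r = step e′ (outside-reaches-x (λ W′ → out (walk-snoc W′ (adj-sym rest e′))) W)
    where
    e′ : Adj rest s _
    e′ = del-keep G x r e λ { (inj₁ (s≡x , _)) → s≢x s≡x ; (inj₂ (s≡r , _)) → s≢r s≡r }

  -- A branch move turns a tree into a tree: the deleted edge xr is replaced
  -- by the detour x ⇝ y – r, and the new edge joins two components of G − xr.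
  moved-acyclic : Acyclic G → Acyclic moved
  moved-acyclic acyclic = add-acyclic rest r y r≢y (acyclic-⊆ (del-⊆ G x r) acyclic) outside

  moved-tree : IsTree G → IsTree moved
  moved-tree (connected , acyclic) = lift ∘₂ connected , moved-acyclic acyclic
    where
    x⇝r : Walk moved x r
    x⇝r = walk-snoc (walk-map (add-⊇ rest r y r≢y) (walk-reverse rest (outside-reaches-x outside (connected y x))))
                    (adj-sym moved (add-new rest r y r≢y))
    lift : {a b : Fin n} → Walk G a b → Walk moved a b
    lift (here _) = here _
    lift {a} (step {w = m} e W) with T? (isEdge x r a m)
    ... | no old = step (add-⊇ rest r y r≢y (del-keep G x r e (old ∘ isEdge-complete))) (lift W)
    ... | yes new with isEdge-sound {p = x} {r} {a} {m} new
    ...   | inj₁ (refl , refl) = x⇝r ++ʷ lift W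
    ...   | inj₂ (refl , refl) = walk-reverse moved x⇝r ++ʷ lift W

  x≢r : ¬ x ≡ r
  x≢r = adj-≢ G xr

  d d′ S : Vector ℤ n
  d  = degs G
  d′ = degs moved
  S  = A G ▷ d

  ry-new : ¬ Adj rest r y
  ry-new e = outside (step e (here y))

  A-moved : ∀ i j → A moved i j ≡ A G i j - E x r i j + E r y i j
  A-moved i j = trans (A-add rest r≢y ry-new i j) (cong (_+ E r y i j) (A-del G xr i j))

  degs-moved : ∀ i → d′ i ≡ shift x y d i
  degs-moved i = begin
    d′ i                                                  ≡⟨ degree-row moved i ⟩
    ℤΣ.sum (A moved i)                                    ≡⟨ ℤΣ.sum-cong-≗ (A-moved i) ⟩
    ℤΣ.sum (λ j → A G i j - E x r i j + E r y i j)        ≡⟨ ℤΣ.∑-distrib-+ (λ j → A G i j - E x r i j) (E r y i) ⟩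
    ℤΣ.sum (λ j → A G i j - E x r i j) + ℤΣ.sum (E r y i) ≡⟨ cong (_+ ℤΣ.sum (E r y i)) (∑-distrib-- (A G i) (E x r i)) ⟩
    ℤΣ.sum (A G i) - ℤΣ.sum (E x r i) + ℤΣ.sum (E r y i)  ≡⟨ cong₂ (λ s t → s - t + ℤΣ.sum (E r y i)) (sym (degree-row G i)) (E-row-sum x r i) ⟩
    d i - (δ x i + δ r i) + ℤΣ.sum (E r y i)              ≡⟨ cong (λ t → d i - (δ x i + δ r i) + t) (E-row-sum r y i) ⟩
    d i - (δ x i + δ r i) + (δ r i + δ y i)               ≡⟨ cancel (d i) (δ x i) (δ r i) (δ y i) ⟩
    shift x y d i                                         ∎
    where
    open ≡-Reasoning
    cancel : ∀ a b c e → a - (b + c) + (c + e) ≡ a - b + e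
    cancel = solve-∀

  moved-row : ∀ i → (A moved ▷ d′) i ≡ S i - A G i x + A G i y - (E x r ▷ d′) i + (E r y ▷ d′) i
  moved-row i = begin
    A moved i · d′                                        ≡⟨ ·-comm (A moved i) d′ ⟩
    d′ · A moved i                                        ≡⟨ ℤΣ.sum-cong-≗ (λ j → cong (d′ j *_) (A-moved i j)) ⟩
    d′ · (λ j → A G i j - E x r i j + E r y i j)          ≡⟨ ·-+ʳ d′ (λ j → A G i j - E x r i j) (E r y i) ⟩
    d′ · (λ j → A G i j - E x r i j) + d′ · E r y i       ≡⟨ cong (_+ d′ · E r y i) (·--ʳ d′ (A G i) (E x r i)) ⟩
    d′ · A G i - d′ · E x r i + d′ · E r y i              ≡⟨ cong₂ (λ s t → s - t + d′ · E r y i) (·-comm d′ (A G i)) (·-comm d′ (E x r i)) ⟩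
    A G i · d′ - (E x r ▷ d′) i + d′ · E r y i            ≡⟨ cong (λ t → A G i · d′ - (E x r ▷ d′) i + t) (·-comm d′ (E r y i)) ⟩
    A G i · d′ - (E x r ▷ d′) i + (E r y ▷ d′) i          ≡⟨ cong (λ t → t - (E x r ▷ d′) i + (E r y ▷ d′) i) row ⟩
    S i - A G i x + A G i y - (E x r ▷ d′) i + (E r y ▷ d′) i ∎
    where
    open ≡-Reasoning
    row : A G i · d′ ≡ S i - A G i x + A G i y
    row = trans (ℤΣ.sum-cong-≗ (λ j → cong (A G i j *_) (degs-moved j))) (·-shift (A G i) x y d)

  d′-· : (g : Vector ℤ n) → d′ · g ≡ d · g - g x + g y
  d′-· g = begin
    d′ · g                   ≡⟨ ·-comm d′ g ⟩
    g · d′                   ≡⟨ ℤΣ.sum-cong-≗ (λ j → cong (g j *_) (degs-moved j)) ⟩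
    g · shift x y d          ≡⟨ ·-shift g x y d ⟩
    g · d - g x + g y        ≡⟨ cong (λ t → t - g x + g y) (·-comm g d) ⟩
    d · g - g x + g y        ∎
    where open ≡-Reasoning

  d·column : (a : Fin n) → d · (λ i → A G i a) ≡ S a
  d·column a = ℤΣ.sum-cong-≗ (λ i → trans (ℤP.*-comm (d i) (A G i a)) (cong (_* d i) (A-sym G i a)))

  d′-at-x : d′ x ≡ d x - + 1
  d′-at-x = trans (degs-moved x) (shift-at-x x≢y d)

  d′-at-y : d′ y ≡ d y + + 1
  d′-at-y = trans (degs-moved y) (shift-at-y x≢y d)

  d′-at-r : d′ r ≡ d r
  d′-at-r = trans (degs-moved r) (shift-elsewhere (x≢r ∘ sym) r≢y d)

  moved-row-x : (A moved ▷ d′) x ≡ S x + A G x y - d r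
  moved-row-x = begin
    (A moved ▷ d′) x                                              ≡⟨ moved-row x ⟩
    S x - A G x x + A G x y - (E x r ▷ d′) x + (E r y ▷ d′) x     ≡⟨ cong₂ (λ s t → S x - s + A G x y - t + (E r y ▷ d′) x)
                                                                             (A-irrefl G x) (trans (E▷-at-first x≢r d′) d′-at-r) ⟩
    S x - + 0 + A G x y - d r + (E r y ▷ d′) x                    ≡⟨ cong (λ t → S x - + 0 + A G x y - d r + t) (E▷-elsewhere x≢r x≢y d′) ⟩
    S x - + 0 + A G x y - d r + + 0                               ≡⟨ tidy (S x) (A G x y) (d r) ⟩
    S x + A G x y - d r                                           ∎
    where
    open ≡-Reasoning
    tidy : ∀ s a e → s - + 0 + a - e + + 0 ≡ s + a - e
    tidy = solve-∀

  moved-row-y : (A moved ▷ d′) y ≡ S y - A G x y + d r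
  moved-row-y = begin
    (A moved ▷ d′) y                                              ≡⟨ moved-row y ⟩
    S y - A G y x + A G y y - (E x r ▷ d′) y + (E r y ▷ d′) y     ≡⟨ cong₂ (λ s t → S y - s + t - (E x r ▷ d′) y + (E r y ▷ d′) y)
                                                                             (A-sym G y x) (A-irrefl G y) ⟩
    S y - A G x y + + 0 - (E x r ▷ d′) y + (E r y ▷ d′) y         ≡⟨ cong₂ (λ s t → S y - A G x y + + 0 - s + t)
                                                                             (E▷-elsewhere (x≢y ∘ sym) (r≢y ∘ sym) d′)
                                                                             (trans (E▷-at-second r≢y d′) d′-at-r) ⟩
    S y - A G x y + + 0 - + 0 + d r                               ≡⟨ tidy (S y) (A G x y) (d r) ⟩
    S y - A G x y + d r                                           ∎
    where
    open ≡-Reasoning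
    tidy : ∀ s a e → s - a + + 0 - + 0 + e ≡ s - a + e
    tidy = solve-∀

  d·moved-row : d · (A moved ▷ d′) ≡ d · S - S x + S y + + 2 * d r * (d y - d x + + 1)
  d·moved-row = begin
    d · (A moved ▷ d′)
      ≡⟨ ℤΣ.sum-cong-≗ (λ i → cong (d i *_) (moved-row i)) ⟩
    d · (λ i → S i - A G i x + A G i y - (E x r ▷ d′) i + (E r y ▷ d′) i)
      ≡⟨ ·-combine d S (λ i → A G i x) (λ i → A G i y) (E x r ▷ d′) (E r y ▷ d′) ⟩
    d · S - d · (λ i → A G i x) + d · (λ i → A G i y) - d · (E x r ▷ d′) + d · (E r y ▷ d′)
      ≡⟨ cong₂ (λ s t → d · S - s + t - d · (E x r ▷ d′) + d · (E r y ▷ d′)) (d·column x) (d·column y) ⟩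
    d · S - S x + S y - d · (E x r ▷ d′) + d · (E r y ▷ d′)
      ≡⟨ cong₂ (λ s t → d · S - S x + S y - s + t) (·-E▷ d x r d′) (·-E▷ d r y d′) ⟩
    d · S - S x + S y - (d x * d′ r + d r * d′ x) + (d r * d′ y + d y * d′ r)
      ≡⟨ cong₂ (λ s t → d · S - S x + S y - (d x * d′ r + d r * s) + (d r * t + d y * d′ r)) d′-at-x d′-at-y ⟩
    d · S - S x + S y - (d x * d′ r + d r * (d x - + 1)) + (d r * (d y + + 1) + d y * d′ r)
      ≡⟨ cong (λ t → d · S - S x + S y - (d x * t + d r * (d x - + 1)) + (d r * (d y + + 1) + d y * t)) d′-at-r ⟩
    d · S - S x + S y - (d x * d r + d r * (d x - + 1)) + (d r * (d y + + 1) + d y * d r)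
      ≡⟨ expand (d · S) (S x) (S y) (d x) (d y) (d r) ⟩
    d · S - S x + S y + + 2 * d r * (d y - d x + + 1) ∎
    where
    open ≡-Reasoning
    expand : ∀ Φ sx sy dx dy dr → Φ - sx + sy - (dx * dr + dr * (dx - + 1)) + (dr * (dy + + 1) + dy * dr)
                                   ≡ Φ - sx + sy + + 2 * dr * (dy - dx + + 1)
    expand = solve-∀

  Φ-moved : d′ · (A moved ▷ d′) ≡ d · S + + 2 * (S y - S x) - + 2 * A G x y + + 2 * d r * (d y - d x + + 2)
  Φ-moved = begin
    d′ · (A moved ▷ d′)                                           ≡⟨ d′-· (A moved ▷ d′) ⟩
    d · (A moved ▷ d′) - (A moved ▷ d′) x + (A moved ▷ d′) y      ≡⟨ cong₂ (λ s t → d · (A moved ▷ d′) - s + t) moved-row-x moved-row-y ⟩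
    d · (A moved ▷ d′) - (S x + A G x y - d r) + (S y - A G x y + d r) ≡⟨ cong (λ t → t - (S x + A G x y - d r) + (S y - A G x y + d r)) d·moved-row ⟩
    d · S - S x + S y + + 2 * d r * (d y - d x + + 1) - (S x + A G x y - d r) + (S y - A G x y + d r)
      ≡⟨ collect (d · S) (S x) (S y) (A G x y) (d x) (d y) (d r) ⟩
    d · S + + 2 * (S y - S x) - + 2 * A G x y + + 2 * d r * (d y - d x + + 2) ∎
    where
    open ≡-Reasoning
    collect : ∀ Φ sx sy a dx dy dr →
              Φ - sx + sy + + 2 * dr * (dy - dx + + 1) - (sx + a - dr) + (sy - a + dr)
              ≡ Φ + + 2 * (sy - sx) - + 2 * a + + 2 * dr * (dy - dx + + 2)
    collect = solve-∀

  ZC-moved : Acyclic G → + ZC₁* moved ≡ + ZC₁* G + move-gain G x y r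
  ZC-moved ac = begin
    + ZC₁* moved                                   ≡⟨ ZC-quadratic moved (moved-acyclic ac) ⟩
    d′ · (A moved ▷ d′) - d′ · d′                  ≡⟨ cong₂ _-_ Φ-moved (trans (ℤΣ.sum-cong-≗ (λ i → cong₂ _*_ (degs-moved i) (degs-moved i)))
                                                                               (shift-square x≢y d)) ⟩
    (d · S + + 2 * (S y - S x) - + 2 * A G x y + + 2 * d r * (d y - d x + + 2)) - (d · d + + 2 * (d y - d x) + + 2)
      ≡⟨ regroup (d · S) (d · d) (S x) (S y) (A G x y) (d x) (d y) (d r) ⟩
    (d · S - d · d) + move-gain G x y r            ≡⟨ cong (_+ move-gain G x y r) (sym (ZC-quadratic G ac)) ⟩
    + ZC₁* G + move-gain G x y r                   ∎
    where
    open ≡-Reasoning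
    regroup : ∀ Φ M sx sy a dx dy dr →
      (Φ + + 2 * (sy - sx) - + 2 * a + + 2 * dr * (dy - dx + + 2)) - (M + + 2 * (dy - dx) + + 2)
      ≡ (Φ - M) + (+ 2 * (sy - sx) - + 2 * a + + 2 * dr * (dy - dx + + 2) - + 2 * (dy - dx + + 1))
    regroup = solve-∀

  moved-chemical : Chemical G → deg G y ≤ 3 → Chemical moved
  moved-chemical chem y≤3 i = by-cases (i ≟ y) (i ≟ x)
    where
    by-cases : Dec (i ≡ y) → Dec (i ≡ x) → deg moved i ≤ 4
    by-cases (yes refl) _ = subst (_≤ 4) (sym deg-y) (s≤s y≤3)
      where
      deg-y : deg moved y ≡ suc (deg G y)
      deg-y = ℤP.+-injective (trans d′-at-y (trans (sym (ℤP.pos-+ (deg G y) 1)) (cong +_ (ℕP.+-comm (deg G y) 1))))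
    by-cases (no _) (yes refl) = ℕP.≤-trans (ℕP.n≤1+n (deg moved x)) (subst (_≤ 4) (sym deg-x) (chem x))
      where
      deg-x : suc (deg moved x) ≡ deg G x
      deg-x = ℤP.+-injective (begin
        + suc (deg moved x)     ≡⟨ ℤP.pos-+ 1 (deg moved x) ⟩
        + 1 + d′ x              ≡⟨ cong (λ t → + 1 + t) d′-at-x ⟩
        + 1 + (d x - + 1)       ≡⟨ cancel (d x) ⟩
        d x                     ∎)
        where
        open ≡-Reasoning
        cancel : ∀ a → + 1 + (a - + 1) ≡ a
        cancel = solve-∀
    by-cases (no i≢y) (no i≢x) = subst (_≤ 4) (sym (ℤP.+-injective (trans (degs-moved i) (shift-elsewhere i≢x i≢y d)))) (chem i)

no-gain : (G : Graph n) → ChemicalTree G → ((T : Graph n) → ChemicalTree T → ZC₁* T ≤ ZC₁* G) →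
          {x r y : Fin n} → Adj G x r → ¬ Walk (del G x r) r y → ¬ x ≡ y → deg G y ≤ 3 →
          move-gain G x y r ℤ.≤ + 0
no-gain G (tree , chem) maximal {x} {r} {y} xr outside x≢y y≤3 = begin
  move-gain G x y r                   ≡⟨ cancel (+ ZC₁* G) (move-gain G x y r) ⟩
  (+ ZC₁* G + move-gain G x y r) - + ZC₁* G ≡⟨ cong (_- + ZC₁* G) (sym (ZC-moved (proj₂ tree))) ⟩
  + ZC₁* moved - + ZC₁* G              ≤⟨ ℤP.i≤j⇒i-j≤0 (ℤ.+≤+ (maximal moved (moved-tree tree , moved-chemical chem y≤3))) ⟩
  + 0                                  ∎
  where
  open BranchMove G xr outside x≢y
  open ℤP.≤-Reasoning
  cancel : ∀ z g → g ≡ (z + g) - z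
  cancel = solve-∀

deg-pos : (G : Graph n) {u t : Fin n} → Adj G u t → 1 ≤ deg G u
deg-pos G {u} ut = subst (1 ≤_) (sym (trans (deg-count G u) (count-remove (adj G u) ut))) (s≤s z≤n)

other-neighbours : (G : Graph n) {u t : Fin n} {k : ℕ} → Adj G u t → deg G u ≡ suc k → count (adj G u ∖ t) ≡ k
other-neighbours G {u} ut du = ℕP.suc-injective (trans (sym (count-remove (adj G u) ut)) (trans (sym (deg-count G u)) du))

only-point : (p : Fin n → Bool) {a u : Fin n} → count (p ∖ a) ≡ 0 → T (p u) → u ≡ a
only-point p {a} {u} c0 pu with u ≟ a
... | yes u≡a = u≡a
... | no u≢a = ⊥-elim (count-zero (p ∖ a) c0 u (∖-intro {p = p} pu u≢a))

leaf-neighbour : (G : Graph n) {u t s : Fin n} → deg G u ≤ 1 → Adj G u t → Adj G u s → s ≡ t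
leaf-neighbour G {u} {t} u≤1 ut us = only-point (adj G u) (ℕP.n≤0⇒n≡0 (ℕP.≤-pred (subst (_≤ 1) count-u u≤1))) us
  where
  count-u : deg G u ≡ suc (count (adj G u ∖ t))
  count-u = trans (deg-count G u) (count-remove (adj G u) ut)

closed-set-bound : (G : Graph n) → Connected G → {k : ℕ} (sel : Fin k → Fin n) →
                   ({u t : Fin n} → (∃ λ j → u ≡ sel j) → Adj G u t → ∃ λ j → t ≡ sel j) →
                   {s : Fin n} → (∃ λ j → s ≡ sel j) → n ≤ k
closed-set-bound G connected sel closed {s} s∈ = injective⇒≤ {f = λ u → proj₁ (member u)} injective
  where
  spread : {u t : Fin _} → (∃ λ j → u ≡ sel j) → Walk G u t → ∃ λ j → t ≡ sel j
  spread u∈ (here _) = u∈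
  spread u∈ (step e W) = spread (closed u∈ e) W
  member : ∀ u → ∃ λ j → u ≡ sel j
  member u = spread s∈ (connected s u)
  injective : ∀ {u u′} → proj₁ (member u) ≡ proj₁ (member u′) → u ≡ u′
  injective {u} {u′} eq = trans (proj₂ (member u)) (trans (cong sel eq) (sym (proj₂ (member u′))))

two-neighbours : (G : Graph n) {u : Fin n} {k : ℕ} → deg G u ≡ suc (suc k) →
                 ∃ λ a → ∃ λ b → Adj G u a × Adj G u b × ¬ a ≡ b
two-neighbours G {u} du with peel (adj G u) (trans (sym (deg-count G u)) du)
... | a , ua , rest with peel (adj G u ∖ a) rest
...   | b , ub′ , _ with ∖-sound {p = adj G u} ub′
...     | ub , b≢a = a , b , ua , ub , b≢a ∘ sym

removed-or-remaining : (p : Fin n → Bool) (a : Fin n) {u : Fin n} → T (p u) → u ≡ a ⊎ T ((p ∖ a) u)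
removed-or-remaining p a {u} pu = case u ≟ a of λ
  { (yes u≡a) → inj₁ u≡a
  ; (no u≢a)  → inj₂ (∖-intro {p = p} pu u≢a) }

both-one : {x y : ℕ} → 3 ℕ.* x ℕ.+ y ≤ 4 → 1 ≤ x → 1 ≤ y → x ≤ 1 × y ≤ 1
both-one {x} {y} h x≥1 y≥1 =
  ℕP.*-cancelˡ-≤ 3 (ℕP.+-cancelʳ-≤ 1 (3 ℕ.* x) 3 (ℕP.≤-trans (ℕP.+-monoʳ-≤ (3 ℕ.* x) y≥1) h)) ,
  ℕP.+-cancelˡ-≤ 3 y 1 (ℕP.≤-trans (ℕP.+-monoˡ-≤ y (ℕP.*-monoʳ-≤ 3 x≥1)) h)

gain-sum : (G : Graph n) {v w : Fin n} → deg G v ≡ 2 → deg G w ≡ 3 → (r r′ : Fin n) →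
  move-gain G v w r + move-gain G w v r′ ≡ + 2 * (+ (3 ℕ.* deg G r ℕ.+ deg G r′) - + (2 ℕ.+ 2 ℕ.* ind (adj G v w)))
gain-sum G {v} {w} dv dw r r′ = begin
  move-gain G v w r + move-gain G w v r′
    ≡⟨ cong (λ a → move-gain G v w r + (+ 2 * (S v - S w) - + 2 * a + + 2 * d r′ * (d v - d w + + 2) - + 2 * (d v - d w + + 1)))
            (A-sym G w v) ⟩
  (+ 2 * (S w - S v) - + 2 * A G v w + + 2 * d r * (d w - d v + + 2) - + 2 * (d w - d v + + 1))
    + (+ 2 * (S v - S w) - + 2 * A G v w + + 2 * d r′ * (d v - d w + + 2) - + 2 * (d v - d w + + 1))
    ≡⟨ collect (S v) (S w) (A G v w) (d v) (d w) (d r) (d r′) (cong +_ dv) (cong +_ dw) ⟩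
  + 2 * (+ 3 * d r + d r′ - (+ 2 + + 2 * A G v w))
    ≡⟨ cong₂ (λ s t → + 2 * (s - t)) (sym (cast-lin 3 (deg G r) (deg G r′))) (sym (cast-aff 2 2 (ind (adj G v w)))) ⟩
  + 2 * (+ (3 ℕ.* deg G r ℕ.+ deg G r′) - + (2 ℕ.+ 2 ℕ.* ind (adj G v w))) ∎
  where
  open ≡-Reasoning
  d S : Vector ℤ _
  d = degs G
  S = A G ▷ d
  collect : ∀ sv sw a dv dw dr dr′ → dv ≡ + 2 → dw ≡ + 3 →
    (+ 2 * (sw - sv) - + 2 * a + + 2 * dr * (dw - dv + + 2) - + 2 * (dw - dv + + 1))
      + (+ 2 * (sv - sw) - + 2 * a + + 2 * dr′ * (dv - dw + + 2) - + 2 * (dv - dw + + 1))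
    ≡ + 2 * (+ 3 * dr + dr′ - (+ 2 + + 2 * a))
  collect sv sw a _ _ dr dr′ refl refl = identity sv sw a dr dr′
    where
    identity : ∀ sv sw a dr dr′ →
      (+ 2 * (sw - sv) - + 2 * a + + 2 * dr * (+ 3 - + 2 + + 2) - + 2 * (+ 3 - + 2 + + 1))
        + (+ 2 * (sv - sw) - + 2 * a + + 2 * dr′ * (+ 2 - + 3 + + 2) - + 2 * (+ 2 - + 3 + + 1))
      ≡ + 2 * (+ 3 * dr + dr′ - (+ 2 + + 2 * a))
    identity = solve-∀
  cast-lin : ∀ a b c → + (a ℕ.* b ℕ.+ c) ≡ + a * + b + + c
  cast-lin a b c = trans (ℤP.pos-+ (a ℕ.* b) c) (cong (_+ + c) (ℤP.pos-* a b))
  cast-aff : ∀ a b c → + (a ℕ.+ b ℕ.* c) ≡ + a + + b * + c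
  cast-aff a b c = trans (ℤP.pos-+ a (b ℕ.* c)) (cong (λ t → + a + t) (ℤP.pos-* b c))

module MaximalTree (G : Graph n) (chemical-tree : ChemicalTree G)
                   (maximal : (T : Graph n) → ChemicalTree T → ZC₁* T ≤ ZC₁* G)
                   {v w : Fin n} (dv : deg G v ≡ 2) (dw : deg G w ≡ 3) where

  acyclic : Acyclic G
  acyclic = proj₂ (proj₁ chemical-tree)

  v≢w : ¬ v ≡ w
  v≢w refl with () ← trans (sym dv) dw

  -- Balance: if r is a neighbour of v whose branch avoids w and r′ a
  -- neighbour of w whose branch avoids v, then neither move gains, so
  -- 3 d_r + d_r′ ≤ 2 + 2A_vw.
  balance : {r r′ : Fin n} → Adj G v r → ¬ Walk (del G v r) r w → Adj G w r′ → ¬ Walk (del G w r′) r′ v →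
            3 ℕ.* deg G r ℕ.+ deg G r′ ≤ 2 ℕ.+ 2 ℕ.* ind (adj G v w)
  balance {r} {r′} vr out wr′ out′ = ℤP.drop‿+≤+ (ℤP.i-j≤0⇒i≤j (ℤP.*-cancelˡ-≤-pos _ (+ 0) (+ 2) twice≤0))
    where
    twice≤0 : + 2 * (+ (3 ℕ.* deg G r ℕ.+ deg G r′) - + (2 ℕ.+ 2 ℕ.* ind (adj G v w))) ℤ.≤ + 2 * + 0
    twice≤0 = subst₂ ℤ._≤_ (gain-sum G dv dw r r′) refl
      (ℤP.+-mono-≤ (no-gain G chemical-tree maximal vr out v≢w (ℕP.≤-reflexive dw))
                   (no-gain G chemical-tree maximal wr′ out′ (v≢w ∘ sym) (subst (_≤ 3) (sym dv) (s≤s (s≤s z≤n)))))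

  -- If v and w are not adjacent, take branches at v avoiding w and at w
  -- avoiding v; balance then reads 3 d_r + d_r′ ≤ 2, impossible.
  nonadjacent : ¬ Adj G v w → ⊥
  nonadjacent ¬vw with two-neighbours G dv | two-neighbours G dw
  ... | a , b , va , vb , a≢b | c , e , wc , we , c≢e =
    branch-avoiding G acyclic va vb a≢b λ {r} vr out →
    branch-avoiding G acyclic wc we c≢e λ {r′} wr′ out′ →
    too-heavy (deg-pos G (adj-sym G vr))
              (subst (λ t → 3 ℕ.* deg G r ℕ.+ deg G r′ ≤ 2 ℕ.+ 2 ℕ.* ind t) (¬T⇒≡false ¬vw) (balance vr out wr′ out′))
    where
    too-heavy : {x y : ℕ} → 1 ≤ x → ¬ 3 ℕ.* x ℕ.+ y ≤ 2
    too-heavy {x} {y} x≥1 h with ℕP.≤-trans (ℕP.*-monoʳ-≤ 3 x≥1) (ℕP.≤-trans (ℕP.m≤m+n (3 ℕ.* x) y) h)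
    ... | s≤s (s≤s ())

  -- If v and w are adjacent, balance forces the other neighbour a of v and
  -- the other neighbours c, e of w to be leaves, so G has only 5 vertices.
  adjacent : Adj G v w → n ≤ 5
  adjacent vw with peel (adj G v ∖ w) (other-neighbours G vw dv)
  ... | a , va′ , v-done with peel (adj G w ∖ v) (other-neighbours G (adj-sym G vw) dw)
  ...   | c , wc′ , w-rest with peel ((adj G w ∖ v) ∖ c) w-rest
  ...     | e , we″ , w-done = closed-set-bound G (proj₁ (proj₁ chemical-tree)) select closed (zero , refl)
    where
    va : Adj G v a
    va = proj₁ (∖-sound {p = adj G v} va′)
    wc : Adj G w c
    wc = proj₁ (∖-sound {p = adj G w} wc′)
    we′ : T ((adj G w ∖ v) e)
    we′ = proj₁ (∖-sound {p = adj G w ∖ v} we″)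
    we : Adj G w e
    we = proj₁ (∖-sound {p = adj G w} we′)

    around-v : ∀ {u} → Adj G v u → u ≡ w ⊎ u ≡ a
    around-v vu with removed-or-remaining (adj G v) w vu
    ... | inj₁ u≡w = inj₁ u≡w
    ... | inj₂ vu′ = inj₂ (only-point (adj G v ∖ w) v-done vu′)

    around-w : ∀ {u} → Adj G w u → u ≡ v ⊎ u ≡ c ⊎ u ≡ e
    around-w wu with removed-or-remaining (adj G w) v wu
    ... | inj₁ u≡v = inj₁ u≡v
    ... | inj₂ wu′ with removed-or-remaining (adj G w ∖ v) c wu′
    ...   | inj₁ u≡c = inj₂ (inj₁ u≡c)
    ...   | inj₂ wu″ = inj₂ (inj₂ (only-point ((adj G w ∖ v) ∖ c) w-done wu″))

    balance-with : ∀ {r′} → Adj G w r′ → ¬ r′ ≡ v → deg G a ≤ 1 × deg G r′ ≤ 1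
    balance-with wr′ r′≢v =
      both-one (subst (λ t → 3 ℕ.* deg G a ℕ.+ deg G _ ≤ 2 ℕ.+ 2 ℕ.* ind t) (T⇒≡true vw)
                      (balance va (other-side G acyclic va vw (proj₂ (∖-sound {p = adj G v} va′)))
                               wr′ (other-side G acyclic wr′ (adj-sym G vw) r′≢v)))
               (deg-pos G (adj-sym G va)) (deg-pos G (adj-sym G wr′))

    leaf-a : ∀ {t} → Adj G a t → t ≡ v
    leaf-a = leaf-neighbour G (proj₁ (balance-with wc (proj₂ (∖-sound {p = adj G w} wc′)))) (adj-sym G va)
    leaf-c : ∀ {t} → Adj G c t → t ≡ w
    leaf-c = leaf-neighbour G (proj₂ (balance-with wc (proj₂ (∖-sound {p = adj G w} wc′)))) (adj-sym G wc)
    leaf-e : ∀ {t} → Adj G e t → t ≡ w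
    leaf-e = leaf-neighbour G (proj₂ (balance-with we (proj₂ (∖-sound {p = adj G w} we′)))) (adj-sym G we)

    select : Fin 5 → Fin n
    select zero = v
    select (suc zero) = w
    select (suc (suc zero)) = a
    select (suc (suc (suc zero))) = c
    select (suc (suc (suc (suc zero)))) = e

    closed : ∀ {u t} → (∃ λ j → u ≡ select j) → Adj G u t → ∃ λ j → t ≡ select j
    closed (zero , refl) ut with around-v ut
    ... | inj₁ t≡w = suc zero , t≡w
    ... | inj₂ t≡a = suc (suc zero) , t≡a
    closed (suc zero , refl) ut with around-w ut
    ... | inj₁ t≡v = zero , t≡v
    ... | inj₂ (inj₁ t≡c) = suc (suc (suc zero)) , t≡c
    ... | inj₂ (inj₂ t≡e) = suc (suc (suc (suc zero))) , t≡e
    closed (suc (suc zero) , refl) ut = zero , leaf-a ut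
    closed (suc (suc (suc zero)) , refl) ut = suc zero , leaf-c ut
    closed (suc (suc (suc (suc zero))) , refl) ut = suc zero , leaf-e ut

lemma3p6 : (n : ℕ) → 7 ≤ n → (T* : Graph n) → ChemicalTree T* →
    ((T : Graph n) → ChemicalTree T → ZC₁* T ≤ ZC₁* T*) →
    ¬ ((∃ λ (v : Fin n) → deg T* v ≡ 2) × (∃ λ (w : Fin n) → deg T* w ≡ 3))
lemma3p6 n 7≤n T* chemical-tree maximal ((v , dv) , (w , dw)) with T? (adj T* v w)
... | no ¬vw = nonadjacent ¬vw
  where open MaximalTree T* chemical-tree maximal dv dw
... | yes vw = seven≰five (ℕP.≤-trans 7≤n (adjacent vw))
  where
  open MaximalTree T* chemical-tree maximal dv dw
  seven≰five : ¬ 7 ≤ 5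
  seven≰five (s≤s (s≤s (s≤s (s≤s (s≤s ())))))
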